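{- Let $P$ be a finite poset and let $\mathcal{S}=(S_x:x\in P)$ be an irreducible inclusion representation of $P$. If $|\bigcup\mathcal{S}|=|P|$, then $|S_x|=|D_P[x]|$ for every $x\in P$.
   Context: $D_P[x]=\{u\in P:u\le x\}$. An inclusion representation of $P$ is a family $\mathcal{S}=(S_x:x\in P)$ of sets with $x\le y$ iff $S_x\subseteq S_y$; its ground set is $\bigcup\mathcal{S}$. $\mathcal{S}$ is a reduction of $\mathcal{S}'$ if $|\bigcup\mathcal{S}|\le|\bigcup\mathcal{S}'|$ and $|S_x|\le|S'_x|$ for all $x$; equivalent means mutual reductions; strict reduction means a non-equivalent reduction; irreducible means having no strict reduction. -}

module Defs where

open import Level using (0ℓ)
open import Data.Nat using (ℕ; _≤_)
open import Data.Fin using (Fin)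
open import Data.Fin.Subset using (Subset; _⊆_; ⋃; ∣_∣)
open import Data.List using (map; allFin)
import Data.Vec as Vec
open import Data.Product using (_×_)
open import Function.Bundles using (_⇔_)
open import Relation.Nullary using (¬_)
open import Relation.Binary.Core using (Rel)
open import Relation.Binary.PropositionalEquality using (_≡_)
open import Relation.Binary.Structures using (IsDecPartialOrder)

record FinPoset : Set₁ where
  field
    size  : ℕ
    _≼_   : Rel (Fin size) 0ℓ
    isDecPartialOrder : IsDecPartialOrder _≡_ _≼_
  open IsDecPartialOrder isDecPartialOrder public using (_≤?_)

  ∣D[_]∣ : Fin size → ℕ
  ∣D[ x ]∣ = Vec.count (λ u → u ≤? x) (Vec.allFin size)

open FinPoset public

record InclRep (P : FinPoset) (m : ℕ) : Set where
  field
    S   : Fin (size P) → Subset m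
    rep : ∀ x y → (_≼_ P x y) ⇔ (S x ⊆ S y)

open InclRep public

ground : ∀ {P m} → InclRep P m → Subset m
ground {P} 𝒮 = ⋃ (map (S 𝒮) (allFin (size P)))

IsReduction : ∀ {P m m'} → InclRep P m → InclRep P m' → Set
IsReduction {P} 𝒮 𝒮' =
  (∣ ground 𝒮 ∣ ≤ ∣ ground 𝒮' ∣) × (∀ x → ∣ S 𝒮 x ∣ ≤ ∣ S 𝒮' x ∣)

Equivalent : ∀ {P m m'} → InclRep P m → InclRep P m' → Set
Equivalent 𝒮 𝒮' = IsReduction 𝒮 𝒮' × IsReduction 𝒮' 𝒮

IsStrictReduction : ∀ {P m m'} → InclRep P m → InclRep P m' → Set
IsStrictReduction 𝒮 𝒮' = IsReduction 𝒮 𝒮' × ¬ Equivalent 𝒮 𝒮'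

Irreducible : ∀ {P m} → InclRep P m → Set
Irreducible {P} 𝒮 = ∀ (m' : ℕ) (𝒮' : InclRep P m') → ¬ IsStrictReduction 𝒮' 𝒮

{-# OPTIONS --safe #-}
module Submission where

-- For Q ⊆ P call a point of the ground set confined to Q if it lies only in
-- sets S y with y ∈ Q. Deleting the points confined to Q and adding a fresh copy
-- of Q, with y ∈ Q put into S x exactly when y ≼ x, gives a new inclusion
-- representation restrict Q. Its ground set trades ∣confined Q∣ points for ∣Q∣
-- points, and S x loses ∣S x ∩ confined Q∣ points and gains ∣Q ∩ D[x]∣.
-- For irreducible 𝒮, strong induction on ∣Q∣ shows ∣confined Q∣ ≤ ∣Q∣: otherwise
-- the induction hypothesis, applied to Q ─ D[x], yields the Hall-type bound
-- ∣Q ∩ D[x]∣ ≤ ∣S x ∩ confined Q∣, and restrict Q would be a reduction of 𝒮 with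
-- a smaller ground set. If ∣⋃𝒮∣ = ∣P∣ then every point is confined to P, the
-- bound for Q = P reads ∣D[x]∣ ≤ ∣S x∣, so x ↦ D[x] is a reduction of 𝒮, and
-- irreducibility turns it into an equivalence.

open import Defs
open import Level using (Level; 0ℓ)
open import Data.Bool using (true; false)
open import Data.Nat as ℕ using (ℕ; zero; suc; _+_; _≤_; _<_; z≤n)
open import Data.Nat.Properties
  using (≤-trans; ≤-antisym; ≤-reflexive; <⇒≤; <⇒≱; ≮⇒≥;
         +-suc; +-comm; +-monoʳ-≤; +-monoʳ-<; +-cancelʳ-≤; module ≤-Reasoning)
open import Data.Nat.Induction using (<-wellFounded)
open import Data.Fin using (Fin; zero; suc)
open import Data.Fin.Properties using (all?)
open import Data.Fin.Subset
  using (Subset; inside; outside; _∈_; _∉_; _⊆_; _∩_; _─_; ⋃; ⊤; ∣_∣)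
open import Data.Fin.Subset.Properties
  using (_∈?_; ∈⊤; nonempty?; Empty-unique; ∣⊥∣≡0; ∣⊤∣≡n; ∣p∣≤n; ∉⊥; drop-∷-⊆; p⊆q⇒∣p∣≤∣q∣;
         ∩-comm; ∩-identityˡ; x∈p∩q⁺; x∈p∩q⁻; p∩q⊆p; ∣p∩q∣≤∣p∣;
         p⊆p∪q; q⊆p∪q; x∈p∪q⁻; x∈p∧x∉q⇒x∈p─q; p─q⊆p; p∩q≢∅⇒∣p─q∣<∣p∣)
open import Data.List as List using (allFin)
open import Data.List.Membership.Propositional using () renaming (_∈_ to _∈ₗ_)
open import Data.List.Membership.Propositional.Properties using (∈-allFin)
open import Data.List.Relation.Unary.Any using (here; there)
open import Data.Vec using ([]; _∷_; _++_; tabulate; count; here; there)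
open import Data.Vec.Properties using (lookup∘tabulate; []=⇒lookup; lookup⇒[]=)
open import Data.Product using (_×_; _,_; proj₁; proj₂)
open import Data.Sum using ([_,_]′)
open import Function using (_∘_; id)
open import Function.Bundles using (mk⇔; Equivalence)
open import Induction.WellFounded using (module All)
open import Relation.Binary.Construct.On as On using ()
open import Relation.Binary.PropositionalEquality using (_≡_; refl; sym; trans; cong; subst)
open import Relation.Binary.Structures using (IsDecPartialOrder)
open import Relation.Nullary using (¬_; yes; no; does; contradiction)
open import Relation.Nullary.Decidable using (_×-dec_; _→-dec_; dec-true; decidable-stable)
open import Relation.Unary using (Pred; Decidable)

private
  variable
    ℓ : Level
    k n : ℕ

x∈p─q⇒x∉q : ∀ {x : Fin n} {p q : Subset n} → x ∈ p ─ q → x ∉ q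
x∈p─q⇒x∉q {p = inside ∷ p} {outside ∷ q} here ()
x∈p─q⇒x∉q {p = _ ∷ p} {_ ∷ q} (there x∈p─q) (there x∈q) = x∈p─q⇒x∉q x∈p─q x∈q

─-monoˡ-⊆ : ∀ {p q : Subset n} r → p ⊆ q → p ─ r ⊆ q ─ r
─-monoˡ-⊆ {p = p} r p⊆q x∈p─r =
  x∈p∧x∉q⇒x∈p─q (p⊆q (p─q⊆p p r x∈p─r)) (x∈p─q⇒x∉q x∈p─r)

∣p∣≡∣p∩q∣+∣p─q∣ : ∀ (p q : Subset n) → ∣ p ∣ ≡ ∣ p ∩ q ∣ + ∣ p ─ q ∣
∣p∣≡∣p∩q∣+∣p─q∣ []            []            = refl
∣p∣≡∣p∩q∣+∣p─q∣ (inside  ∷ p) (inside  ∷ q) = cong suc (∣p∣≡∣p∩q∣+∣p─q∣ p q)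
∣p∣≡∣p∩q∣+∣p─q∣ (inside  ∷ p) (outside ∷ q) =
  trans (cong suc (∣p∣≡∣p∩q∣+∣p─q∣ p q)) (sym (+-suc ∣ p ∩ q ∣ ∣ p ─ q ∣))
∣p∣≡∣p∩q∣+∣p─q∣ (outside ∷ p) (inside  ∷ q) = ∣p∣≡∣p∩q∣+∣p─q∣ p q
∣p∣≡∣p∩q∣+∣p─q∣ (outside ∷ p) (outside ∷ q) = ∣p∣≡∣p∩q∣+∣p─q∣ p q

∣p─q∣+∣q∣≤∣p∣ : ∀ {p q : Subset n} → q ⊆ p → ∣ p ─ q ∣ + ∣ q ∣ ≤ ∣ p ∣
∣p─q∣+∣q∣≤∣p∣ {p = p} {q} q⊆p = begin
  ∣ p ─ q ∣ + ∣ q ∣      ≤⟨ +-monoʳ-≤ ∣ p ─ q ∣ (p⊆q⇒∣p∣≤∣q∣ (λ x∈q → x∈p∩q⁺ (q⊆p x∈q , x∈q))) ⟩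
  ∣ p ─ q ∣ + ∣ p ∩ q ∣  ≡⟨ +-comm ∣ p ─ q ∣ ∣ p ∩ q ∣ ⟩
  ∣ p ∩ q ∣ + ∣ p ─ q ∣  ≡⟨ ∣p∣≡∣p∩q∣+∣p─q∣ p q ⟨
  ∣ p ∣                  ∎
  where open ≤-Reasoning

∣p++q∣≡∣p∣+∣q∣ : ∀ (p : Subset n) (q : Subset k) → ∣ p ++ q ∣ ≡ ∣ p ∣ + ∣ q ∣
∣p++q∣≡∣p∣+∣q∣ []            q = refl
∣p++q∣≡∣p∣+∣q∣ (inside  ∷ p) q = cong suc (∣p++q∣≡∣p∣+∣q∣ p q)
∣p++q∣≡∣p∣+∣q∣ (outside ∷ p) q = ∣p++q∣≡∣p∣+∣q∣ p q

⊆-++⁺ : ∀ {p p' : Subset n} {q q' : Subset k} → p ⊆ p' → q ⊆ q' → p ++ q ⊆ p' ++ q'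
⊆-++⁺ {p = []}    {[]}     _     q⊆q' x∈ = q⊆q' x∈
⊆-++⁺ {p = _ ∷ _} {_ ∷ _}  p⊆p' _    here with p⊆p' here
... | here = here
⊆-++⁺ {p = _ ∷ _} {_ ∷ _}  p⊆p' q⊆q' (there x∈) = there (⊆-++⁺ (drop-∷-⊆ p⊆p') q⊆q' x∈)

⊆-++⁻ˡ : ∀ {p p' : Subset n} {q q' : Subset k} → p ++ q ⊆ p' ++ q' → p ⊆ p'
⊆-++⁻ˡ {p = _ ∷ _} {_ ∷ _} p++q⊆p'++q' here with p++q⊆p'++q' here
... | here = here
⊆-++⁻ˡ {p = _ ∷ _} {_ ∷ _} p++q⊆p'++q' (there x∈) = there (⊆-++⁻ˡ (drop-∷-⊆ p++q⊆p'++q') x∈)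

⊆-++⁻ʳ : ∀ {p p' : Subset n} {q q' : Subset k} → p ++ q ⊆ p' ++ q' → q ⊆ q'
⊆-++⁻ʳ {p = []}    {[]}    p++q⊆p'++q' = p++q⊆p'++q'
⊆-++⁻ʳ {p = _ ∷ p} {_ ∷ _} p++q⊆p'++q' = ⊆-++⁻ʳ {p = p} (drop-∷-⊆ p++q⊆p'++q')

module _ {a} {A : Set a} (f : A → Subset n) where

  ⊆-⋃-map : ∀ {x xs} → x ∈ₗ xs → f x ⊆ ⋃ (List.map f xs)
  ⊆-⋃-map (here refl)                   = p⊆p∪q _
  ⊆-⋃-map {xs = y List.∷ _} (there x∈xs) = q⊆p∪q (f y) _ ∘ ⊆-⋃-map x∈xs

  ⋃-map-⊆ : ∀ {r} xs → (∀ x → f x ⊆ r) → ⋃ (List.map f xs) ⊆ r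
  ⋃-map-⊆ List.[]       _   e∈ = contradiction e∈ ∉⊥
  ⋃-map-⊆ (x List.∷ xs) f⊆r e∈ = [ f⊆r x , ⋃-map-⊆ xs f⊆r ]′ (x∈p∪q⁻ (f x) _ e∈)

module _ {P : Pred (Fin n) ℓ} (P? : Decidable P) where

  subsetOf : Subset n
  subsetOf = tabulate (does ∘ P?)

  ∈-subsetOf⁺ : ∀ {i} → P i → i ∈ subsetOf
  ∈-subsetOf⁺ {i} Pi =
    lookup⇒[]= i subsetOf (trans (lookup∘tabulate (does ∘ P?) i) (dec-true (P? i) Pi))

  ∈-subsetOf⁻ : ∀ {i} → i ∈ subsetOf → P i
  ∈-subsetOf⁻ {i} i∈ with P? i | trans (sym (lookup∘tabulate (does ∘ P?) i)) ([]=⇒lookup i∈)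
  ... | yes Pi | _  = Pi
  ... | no  _  | ()

module _ {a} {A : Set a} {P : Pred A ℓ} (P? : Decidable P) where

  ∣tabulate∣≡count : ∀ (f : Fin k → A) → ∣ tabulate (does ∘ P? ∘ f) ∣ ≡ count P? (tabulate f)
  ∣tabulate∣≡count {zero}  f = refl
  ∣tabulate∣≡count {suc k} f with does (P? (f zero))
  ... | true  = cong suc (∣tabulate∣≡count (f ∘ suc))
  ... | false = ∣tabulate∣≡count (f ∘ suc)

module _ (P : FinPoset) where
  open IsDecPartialOrder (isDecPartialOrder P) using () renaming (refl to ≼-refl; trans to ≼-trans)

  downset : Fin (size P) → Subset (size P)
  downset x = subsetOf (λ u → _≤?_ P u x)

  ∈-downset⁺ : ∀ {u x} → _≼_ P u x → u ∈ downset x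
  ∈-downset⁺ {x = x} = ∈-subsetOf⁺ (λ u → _≤?_ P u x)

  ∈-downset⁻ : ∀ {u x} → u ∈ downset x → _≼_ P u x
  ∈-downset⁻ {x = x} = ∈-subsetOf⁻ (λ u → _≤?_ P u x)

  x∈downset : ∀ x → x ∈ downset x
  x∈downset x = ∈-downset⁺ ≼-refl

  ∣downset∣≡∣D∣ : ∀ x → ∣ downset x ∣ ≡ ∣D[_]∣ P x
  ∣downset∣≡∣D∣ x = ∣tabulate∣≡count (λ u → _≤?_ P u x) id

  downsetRep : InclRep P (size P)
  downsetRep = record { S = downset ; rep = λ x y → mk⇔ ≼⇒⊆ ⊆⇒≼ }
    where
    ≼⇒⊆ : ∀ {x y} → _≼_ P x y → downset x ⊆ downset y
    ≼⇒⊆ x≼y u∈↓x = ∈-downset⁺ (≼-trans (∈-downset⁻ u∈↓x) x≼y)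
    ⊆⇒≼ : ∀ {x y} → downset x ⊆ downset y → _≼_ P x y
    ⊆⇒≼ {x} ↓x⊆↓y = ∈-downset⁻ (↓x⊆↓y (x∈downset x))

module _ {P : FinPoset} {m : ℕ} (𝒮 : InclRep P m) where

  S⊆ground : ∀ x → S 𝒮 x ⊆ ground 𝒮
  S⊆ground x = ⊆-⋃-map (S 𝒮) (∈-allFin x)

  ground⊆ : ∀ {r} → (∀ x → S 𝒮 x ⊆ r) → ground 𝒮 ⊆ r
  ground⊆ = ⋃-map-⊆ (S 𝒮) (allFin (size P))

  reduction⇒equivalent : Irreducible 𝒮 → ∀ {m'} (𝒮' : InclRep P m') →
    IsReduction 𝒮' 𝒮 → Equivalent 𝒮' 𝒮
  reduction⇒equivalent irr 𝒮' 𝒮'≤𝒮 = 𝒮'≤𝒮 , ground≤ , S≤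
    where
    ¬¬equivalent : ¬ ¬ Equivalent 𝒮' 𝒮
    ¬¬equivalent = irr _ 𝒮' ∘ (𝒮'≤𝒮 ,_)
    ground≤ : ∣ ground 𝒮 ∣ ≤ ∣ ground 𝒮' ∣
    ground≤ = decidable-stable (_ ℕ.≤? _) λ ≰ → ¬¬equivalent (≰ ∘ proj₁ ∘ proj₂)
    S≤ : ∀ x → ∣ S 𝒮 x ∣ ≤ ∣ S 𝒮' x ∣
    S≤ x = decidable-stable (_ ℕ.≤? _) λ ≰ → ¬¬equivalent (λ eq → ≰ (proj₂ (proj₂ eq) x))

module _ {P : FinPoset} {m : ℕ} (𝒮 : InclRep P m) where

  private
    ≼⇒S⊆ : ∀ {x y} → _≼_ P x y → S 𝒮 x ⊆ S 𝒮 y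
    ≼⇒S⊆ = Equivalence.to (rep 𝒮 _ _)

    S⊆⇒≼ : ∀ {x y} → S 𝒮 x ⊆ S 𝒮 y → _≼_ P x y
    S⊆⇒≼ = Equivalence.from (rep 𝒮 _ _)

  ConfinedTo : Subset (size P) → Pred (Fin m) 0ℓ
  ConfinedTo Q e = e ∈ ground 𝒮 × (∀ y → e ∈ S 𝒮 y → y ∈ Q)

  confinedTo? : ∀ Q → Decidable (ConfinedTo Q)
  confinedTo? Q e = e ∈? ground 𝒮 ×-dec all? (λ y → e ∈? S 𝒮 y →-dec y ∈? Q)

  confined : Subset (size P) → Subset m
  confined Q = subsetOf (confinedTo? Q)

  confined⊆ground : ∀ {Q} → confined Q ⊆ ground 𝒮
  confined⊆ground = proj₁ ∘ ∈-subsetOf⁻ (confinedTo? _)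

  confined-owner : ∀ {Q e y} → e ∈ confined Q → e ∈ S 𝒮 y → y ∈ Q
  confined-owner e∈C = proj₂ (∈-subsetOf⁻ (confinedTo? _) e∈C) _

  ground⊆confined⊤ : ground 𝒮 ⊆ confined ⊤
  ground⊆confined⊤ e∈ground = ∈-subsetOf⁺ (confinedTo? ⊤) (e∈ground , λ _ _ → ∈⊤)

  confined─S⊆confined─downset : ∀ Q x → confined Q ─ S 𝒮 x ⊆ confined (Q ─ downset P x)
  confined─S⊆confined─downset Q x {e} e∈C─Sx =
    ∈-subsetOf⁺ (confinedTo? _) (confined⊆ground e∈C , owner)
    where
    e∈C : e ∈ confined Q
    e∈C = p─q⊆p _ _ e∈C─Sx
    owner : ∀ y → e ∈ S 𝒮 y → y ∈ Q ─ downset P x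
    owner y e∈Sy = x∈p∧x∉q⇒x∈p─q (confined-owner e∈C e∈Sy)
      (λ y∈↓x → x∈p─q⇒x∉q e∈C─Sx (≼⇒S⊆ (∈-downset⁻ P y∈↓x) e∈Sy))

  restrict : Subset (size P) → InclRep P (m + size P)
  restrict Q = record { S = Sᵣ ; rep = λ x y → mk⇔ ≼⇒⊆ ⊆⇒≼ }
    where
    Sᵣ : Fin (size P) → Subset (m + size P)
    Sᵣ x = (S 𝒮 x ─ confined Q) ++ (Q ∩ downset P x)
    ≼⇒⊆ : ∀ {x y} → _≼_ P x y → Sᵣ x ⊆ Sᵣ y
    ≼⇒⊆ {x} {y} x≼y = ⊆-++⁺ (─-monoˡ-⊆ (confined Q) (≼⇒S⊆ {x} {y} x≼y)) λ u∈Q∩↓x →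
      let u∈Q , u∈↓x = x∈p∩q⁻ Q _ u∈Q∩↓x
      in  x∈p∩q⁺ (u∈Q , Equivalence.to (rep (downsetRep P) x y) x≼y u∈↓x)
    ⊆⇒≼ : ∀ {x y} → Sᵣ x ⊆ Sᵣ y → _≼_ P x y
    ⊆⇒≼ {x} {y} Sᵣx⊆Sᵣy = S⊆⇒≼ Sx⊆Sy
      where
      Sx⊆Sy : S 𝒮 x ⊆ S 𝒮 y
      Sx⊆Sy {e} e∈Sx with e ∈? confined Q
      ... | no e∉C  = p─q⊆p _ _ (⊆-++⁻ˡ Sᵣx⊆Sᵣy (x∈p∧x∉q⇒x∈p─q e∈Sx e∉C))
      ... | yes e∈C = ≼⇒S⊆ (∈-downset⁻ P (proj₂ (x∈p∩q⁻ _ _ x∈Q∩↓y))) e∈Sx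
        where
        x∈Q∩↓y : x ∈ Q ∩ downset P y
        x∈Q∩↓y = ⊆-++⁻ʳ {p = S 𝒮 x ─ confined Q} Sᵣx⊆Sᵣy
                   (x∈p∩q⁺ (confined-owner e∈C e∈Sx , x∈downset P x))

  ∣ground-restrict∣≤ : ∀ Q → ∣ ground (restrict Q) ∣ ≤ ∣ ground 𝒮 ─ confined Q ∣ + ∣ Q ∣
  ∣ground-restrict∣≤ Q = ≤-trans (p⊆q⇒∣p∣≤∣q∣ ground-restrict⊆)
                                 (≤-reflexive (∣p++q∣≡∣p∣+∣q∣ (ground 𝒮 ─ confined Q) Q))
    where
    ground-restrict⊆ : ground (restrict Q) ⊆ (ground 𝒮 ─ confined Q) ++ Q
    ground-restrict⊆ = ground⊆ (restrict Q) λ x →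
      ⊆-++⁺ (─-monoˡ-⊆ (confined Q) (S⊆ground 𝒮 x)) (p∩q⊆p Q (downset P x))

  hall-bound : ∀ Q → (∀ {Q'} → ∣ Q' ∣ < ∣ Q ∣ → ∣ confined Q' ∣ ≤ ∣ Q' ∣) → ∣ Q ∣ ≤ ∣ confined Q ∣ →
         ∀ x → ∣ Q ∩ downset P x ∣ ≤ ∣ S 𝒮 x ∩ confined Q ∣
  hall-bound Q ih Q≤C x with nonempty? (Q ∩ downset P x)
  ... | no empty =
    ≤-trans (≤-reflexive (trans (cong ∣_∣ (Empty-unique empty)) (∣⊥∣≡0 (size P)))) z≤n
  ... | yes nonempty =
    -- The induction hypothesis for Q ─ downset x controls the confined points outside S x.
    subst (_ ≤_) (cong ∣_∣ (∩-comm C (S 𝒮 x))) (+-cancelʳ-≤ ∣ Q ─ ↓x ∣ _ _ counted)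
    where
    ↓x = downset P x
    C  = confined Q
    C─Sx≤Q─↓x : ∣ C ─ S 𝒮 x ∣ ≤ ∣ Q ─ ↓x ∣
    C─Sx≤Q─↓x = ≤-trans (p⊆q⇒∣p∣≤∣q∣ (confined─S⊆confined─downset Q x))
                        (ih (p∩q≢∅⇒∣p─q∣<∣p∣ Q ↓x nonempty))
    counted : ∣ Q ∩ ↓x ∣ + ∣ Q ─ ↓x ∣ ≤ ∣ C ∩ S 𝒮 x ∣ + ∣ Q ─ ↓x ∣
    counted = begin
      ∣ Q ∩ ↓x ∣ + ∣ Q ─ ↓x ∣         ≡⟨ ∣p∣≡∣p∩q∣+∣p─q∣ Q ↓x ⟨
      ∣ Q ∣                           ≤⟨ Q≤C ⟩
      ∣ C ∣                           ≡⟨ ∣p∣≡∣p∩q∣+∣p─q∣ C (S 𝒮 x) ⟩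
      ∣ C ∩ S 𝒮 x ∣ + ∣ C ─ S 𝒮 x ∣  ≤⟨ +-monoʳ-≤ ∣ C ∩ S 𝒮 x ∣ C─Sx≤Q─↓x ⟩
      ∣ C ∩ S 𝒮 x ∣ + ∣ Q ─ ↓x ∣     ∎
      where open ≤-Reasoning

  restrict-reduction : ∀ Q → ∣ Q ∣ ≤ ∣ confined Q ∣ →
    (∀ x → ∣ Q ∩ downset P x ∣ ≤ ∣ S 𝒮 x ∩ confined Q ∣) → IsReduction (restrict Q) 𝒮
  restrict-reduction Q Q≤C hallQ = ground≤ , S≤
    where
    open ≤-Reasoning
    ground≤ : ∣ ground (restrict Q) ∣ ≤ ∣ ground 𝒮 ∣
    ground≤ = begin
      ∣ ground (restrict Q) ∣                      ≤⟨ ∣ground-restrict∣≤ Q ⟩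
      ∣ ground 𝒮 ─ confined Q ∣ + ∣ Q ∣            ≤⟨ +-monoʳ-≤ _ Q≤C ⟩
      ∣ ground 𝒮 ─ confined Q ∣ + ∣ confined Q ∣   ≤⟨ ∣p─q∣+∣q∣≤∣p∣ confined⊆ground ⟩
      ∣ ground 𝒮 ∣                                 ∎
    S≤ : ∀ x → ∣ S (restrict Q) x ∣ ≤ ∣ S 𝒮 x ∣
    S≤ x = begin
      ∣ S (restrict Q) x ∣
        ≡⟨ ∣p++q∣≡∣p∣+∣q∣ (S 𝒮 x ─ confined Q) (Q ∩ downset P x) ⟩
      ∣ S 𝒮 x ─ confined Q ∣ + ∣ Q ∩ downset P x ∣
        ≤⟨ +-monoʳ-≤ _ (hallQ x) ⟩
      ∣ S 𝒮 x ─ confined Q ∣ + ∣ S 𝒮 x ∩ confined Q ∣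
        ≡⟨ +-comm _ ∣ S 𝒮 x ∩ confined Q ∣ ⟩
      ∣ S 𝒮 x ∩ confined Q ∣ + ∣ S 𝒮 x ─ confined Q ∣
        ≡⟨ ∣p∣≡∣p∩q∣+∣p─q∣ (S 𝒮 x) (confined Q) ⟨
      ∣ S 𝒮 x ∣
        ∎

  ∣ground-restrict∣< : ∀ Q → ∣ Q ∣ < ∣ confined Q ∣ → ∣ ground (restrict Q) ∣ < ∣ ground 𝒮 ∣
  ∣ground-restrict∣< Q Q<C = begin-strict
    ∣ ground (restrict Q) ∣                      ≤⟨ ∣ground-restrict∣≤ Q ⟩
    ∣ ground 𝒮 ─ confined Q ∣ + ∣ Q ∣            <⟨ +-monoʳ-< _ Q<C ⟩
    ∣ ground 𝒮 ─ confined Q ∣ + ∣ confined Q ∣   ≤⟨ ∣p─q∣+∣q∣≤∣p∣ confined⊆ground ⟩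
    ∣ ground 𝒮 ∣                                 ∎
    where open ≤-Reasoning

  confined-bounded : Irreducible 𝒮 → ∀ Q → ∣ confined Q ∣ ≤ ∣ Q ∣
  confined-bounded irr = All.wfRec (On.wellFounded ∣_∣ <-wellFounded) 0ℓ _ step
    where
    step : ∀ Q → (∀ {Q'} → ∣ Q' ∣ < ∣ Q ∣ → ∣ confined Q' ∣ ≤ ∣ Q' ∣) → ∣ confined Q ∣ ≤ ∣ Q ∣
    step Q ih = ≮⇒≥ λ Q<C →
      let restrict≤𝒮 = restrict-reduction Q (<⇒≤ Q<C) (hall-bound Q ih (<⇒≤ Q<C))
          𝒮≤restrict = proj₂ (reduction⇒equivalent 𝒮 irr (restrict Q) restrict≤𝒮)
      in  <⇒≱ (∣ground-restrict∣< Q Q<C) (proj₁ 𝒮≤restrict)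

  downsetRep-reduction : Irreducible 𝒮 → ∣ ground 𝒮 ∣ ≡ size P → IsReduction (downsetRep P) 𝒮
  downsetRep-reduction irr ∣ground∣≡n = ground≤ , downset≤S
    where
    open ≤-Reasoning
    ground≤ : ∣ ground (downsetRep P) ∣ ≤ ∣ ground 𝒮 ∣
    ground≤ = subst (_ ≤_) (sym ∣ground∣≡n) (∣p∣≤n (ground (downsetRep P)))
    ⊤≤confined⊤ : ∣ ⊤ {size P} ∣ ≤ ∣ confined ⊤ ∣
    ⊤≤confined⊤ = ≤-trans (≤-reflexive (trans (∣⊤∣≡n (size P)) (sym ∣ground∣≡n)))
                          (p⊆q⇒∣p∣≤∣q∣ ground⊆confined⊤)
    downset≤S : ∀ x → ∣ downset P x ∣ ≤ ∣ S 𝒮 x ∣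
    downset≤S x = begin
      ∣ downset P x ∣           ≡⟨ cong ∣_∣ (∩-identityˡ (downset P x)) ⟨
      ∣ ⊤ ∩ downset P x ∣       ≤⟨ hall-bound ⊤ (λ _ → confined-bounded irr _) ⊤≤confined⊤ x ⟩
      ∣ S 𝒮 x ∩ confined ⊤ ∣    ≤⟨ ∣p∩q∣≤∣p∣ (S 𝒮 x) (confined ⊤) ⟩
      ∣ S 𝒮 x ∣                 ∎

corollary2p3 : (P : FinPoset) (m : ℕ) (𝒮 : InclRep P m) →
    Irreducible 𝒮 →
    ∣ ground 𝒮 ∣ ≡ size P →
    ∀ x → ∣ S 𝒮 x ∣ ≡ ∣D[_]∣ P x
corollary2p3 P m 𝒮 irr ∣ground∣≡n x =
  trans (≤-antisym S≤downset downset≤S) (∣downset∣≡∣D∣ P x)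
  where
  downsetRep≤𝒮 : IsReduction (downsetRep P) 𝒮
  downsetRep≤𝒮 = downsetRep-reduction 𝒮 irr ∣ground∣≡n
  downset≤S : ∣ downset P x ∣ ≤ ∣ S 𝒮 x ∣
  downset≤S = proj₂ downsetRep≤𝒮 x
  S≤downset : ∣ S 𝒮 x ∣ ≤ ∣ downset P x ∣
  S≤downset = proj₂ (proj₂ (reduction⇒equivalent 𝒮 irr (downsetRep P) downsetRep≤𝒮)) x
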